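{- Let $T_1$ be a heap-ordered tree, let $v,w$ be nodes of $T_1$ with $u=\mathit{nca}_{T_1}(v,w)\notin\{v,w\}$, let $q$ be the child of $u$ that is an ancestor of $v$, and let $T_2$ be the subtree of $T_1$ rooted at $q$. Let $T_1'$ be a rooted tree equivalent to $T_1$, rerooted at $v$, and let $r$ be the parent of $u$ in $T_1'$. Deleting the arc from $u$ to $r$ breaks $T_1'$ into two trees; let $T_2'$ be the one containing $v$. Then $T_2'$ contains all the nodes of $T_2$, and any node in $T_2'$ but not in $T_2$ is not a descendant of $u$ in $T_1$.
   Context: A heap-ordered tree is a rooted tree whose nodes are distinct elements of a totally ordered set, with every non-root node greater than its parent. For a tree $S$ and nodes $a,b$ of $S$, $S[a,b]$ denotes the set of nodes on the unique path connecting $a$ and $b$ in $S$, ignoring arc directions. Two rooted trees $S$ and $S'$ (nodes from a totally ordered set; $S'$ need not be heap-ordered) are equivalent if they have the same node set and $\min(S[a,b])=\min(S'[a,b])$ for all nodes $a,b$. Rerooting a tree at $v$ means reversing the direction of every arc on the path from $v$ to the root (this preserves equivalence). -}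

module Defs where

open import Data.Nat using (ℕ; _≤_; _<_)
open import Data.List using (List; []; _∷_)
open import Data.List.Membership.Propositional using (_∈_)
open import Data.List.Relation.Unary.Unique.Propositional using (Unique)
open import Data.Product using (Σ; _×_; ∃)
open import Data.Sum using (_⊎_)
open import Relation.Binary.PropositionalEquality using (_≡_; _≢_)
open import Relation.Nullary using (¬_)
open import Function.Bundles using (_⇔_)

-- Nodes are natural numbers (a totally ordered set, with the usual order ≤).

-- Raw data of a rooted tree: node list, root, parent function (the value
-- of `parent` is only meaningful on non-root nodes).
record RawTree : Set where
  field
    nodes  : List ℕ
    root   : ℕ
    parent : ℕ → ℕ
open RawTree public

data Anc (T : RawTree) : ℕ → ℕ → Set where
  here : ∀ {x} → x ∈ nodes T → Anc T x x
  step : ∀ {a x} → x ∈ nodes T → x ≢ root T →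
         Anc T a (parent T x) → Anc T a x

record IsTree (T : RawTree) : Set where
  field
    uniq    : Unique (nodes T)
    root∈   : root T ∈ nodes T
    parent∈ : ∀ x → x ∈ nodes T → x ≢ root T → parent T x ∈ nodes T
    reach   : ∀ x → x ∈ nodes T → Anc T (root T) x

HeapOrdered : RawTree → Set
HeapOrdered T = ∀ x → x ∈ nodes T → x ≢ root T → parent T x < x

Arc : RawTree → ℕ → ℕ → Set
Arc T x y = x ∈ nodes T × x ≢ root T × parent T x ≡ y

Adj : RawTree → ℕ → ℕ → Set
Adj T x y = Arc T x y ⊎ Arc T y x

data Walk (T : RawTree) (R : ℕ → ℕ → Set) : ℕ → ℕ → List ℕ → Set where
  stop : ∀ {x} → x ∈ nodes T → Walk T R x x (x ∷ [])
  go   : ∀ {x y z p} → R x y → Walk T R y z p → Walk T R x z (x ∷ p)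

-- c ∈ S[a,b] : c lies on the (unique) simple path between a and b in S,
-- ignoring arc directions.
OnPath : RawTree → ℕ → ℕ → ℕ → Set
OnPath S a b c = ∃ λ p → Walk S (Adj S) a b p × Unique p × c ∈ p

IsPathMin : RawTree → ℕ → ℕ → ℕ → Set
IsPathMin S a b m = OnPath S a b m × (∀ c → OnPath S a b c → m ≤ c)

Equivalent : RawTree → RawTree → Set
Equivalent S S' =
  (∀ x → (x ∈ nodes S) ⇔ (x ∈ nodes S')) ×
  (∀ a b → a ∈ nodes S → b ∈ nodes S →
     ∃ λ m → IsPathMin S a b m × IsPathMin S' a b m)

IsNCA : RawTree → ℕ → ℕ → ℕ → Set
IsNCA T v w u = Anc T u v × Anc T u w ×
  (∀ a → Anc T a v → Anc T a w → Anc T a u)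

IsArcUR : ℕ → ℕ → ℕ → ℕ → Set
IsArcUR u r x y = (x ≡ u × y ≡ r) ⊎ (x ≡ r × y ≡ u)

AdjDel : RawTree → ℕ → ℕ → ℕ → ℕ → Set
AdjDel T u r x y = Adj T x y × ¬ IsArcUR u r x y

InComponentDel : RawTree → ℕ → ℕ → ℕ → ℕ → Set
InComponentDel T u r v c = ∃ λ p → Walk T (AdjDel T u r) v c p

-- Let D be the subtree of a tree rooted at a. An arc leaves D only as the arc
-- between a and its parent, so a simple path with both ends in D stays in D,
-- one with both ends outside D avoids D, and a walk that does not use the arc
-- above a cannot enter D from outside.
--
-- Since T₁ is heap-ordered, every node on the T₁-path between two nodes of the
-- subtree at q is at least q > u; the minimum of that path is shared by the
-- T₁'-path, which therefore avoids u and survives deleting the arc {u, r}.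
-- Conversely, if x lies below u but not below q, the T₁-path from v to x passes
-- through u = parent q and otherwise stays below u, so its minimum is u and u
-- lies on the T₁'-path from v to x. In T₁', rooted at v, neither v nor x (which
-- is reached without the arc above u) lies below u, so that path avoids u.
module Submission where

open import Defs
open import Data.Nat using (ℕ; _≤_; _<_; _≟_)
open import Data.Nat.Properties using (≤-refl; <⇒≤; ≤-<-trans; <-≤-trans; ≤-antisym; <-irrefl)
open import Data.List.Membership.Propositional using (_∈_; _∉_)
open import Data.List.Relation.Unary.Any using (here; there)
open import Data.List.Relation.Unary.All as All using (All; []; _∷_)
open import Data.List.Relation.Unary.AllPairs using (_∷_)
open import Data.List.Relation.Unary.Unique.Propositional using (Unique)
open import Data.Product using (_×_; _,_; proj₁; proj₂)
open import Data.Sum using (inj₁; inj₂)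
open import Data.Empty using (⊥-elim)
open import Function using (_∘_)
open import Function.Bundles using (Equivalence)
open import Relation.Binary.PropositionalEquality using (_≡_; _≢_; refl; subst)
open import Relation.Nullary using (¬_; Dec; yes; no)

module _ {T : RawTree} where

  Anc-top∈ : ∀ {a x} → Anc T a x → a ∈ nodes T
  Anc-top∈ (here a∈)      = a∈
  Anc-top∈ (step _ _ anc) = Anc-top∈ anc

  Anc-bottom∈ : ∀ {a x} → Anc T a x → x ∈ nodes T
  Anc-bottom∈ (here x∈)     = x∈
  Anc-bottom∈ (step x∈ _ _) = x∈

  Anc-root⇒≡root : ∀ {a} → Anc T a (root T) → a ≡ root T
  Anc-root⇒≡root (here _)          = refl
  Anc-root⇒≡root (step _ root≢ _) = ⊥-elim (root≢ refl)

  HeapOrdered⇒Anc⇒≤ : HeapOrdered T → ∀ {a x} → Anc T a x → a ≤ x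
  HeapOrdered⇒Anc⇒≤ heap (here _) = ≤-refl
  HeapOrdered⇒Anc⇒≤ heap (step {x = x} x∈ x≢ anc) =
    <⇒≤ (≤-<-trans (HeapOrdered⇒Anc⇒≤ heap anc) (heap x x∈ x≢))

  Anc?-below-root : ∀ a {x} → Anc T (root T) x → Dec (Anc T a x)
  Anc?-below-root a (here root∈) with a ≟ root T
  ... | yes refl = yes (here root∈)
  ... | no a≢    = no (a≢ ∘ Anc-root⇒≡root)
  Anc?-below-root a {x} (step x∈ x≢ anc) with a ≟ x
  ... | yes refl = yes (here x∈)
  ... | no a≢x with Anc?-below-root a anc
  ...   | yes above = yes (step x∈ x≢ above)
  ...   | no ¬above = no λ { (here _) → a≢x refl ; (step _ _ above) → ¬above above }

  Adj-sym : ∀ {x y} → Adj T x y → Adj T y x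
  Adj-sym (inj₁ arc) = inj₂ arc
  Adj-sym (inj₂ arc) = inj₁ arc

  Walk-start∈ : ∀ {R x z p} → Walk T R x z p → x ∈ p
  Walk-start∈ (stop _) = here refl
  Walk-start∈ (go _ _) = here refl

  Walk-start∈nodes : IsTree T → ∀ {x z p} → Walk T (Adj T) x z p → x ∈ nodes T
  Walk-start∈nodes tree (stop x∈)                      = x∈
  Walk-start∈nodes tree (go (inj₁ (x∈ , _)) _)          = x∈
  Walk-start∈nodes tree (go (inj₂ (y∈ , y≢ , refl)) _) = IsTree.parent∈ tree _ y∈ y≢

  Walk-delete : ∀ {u r s t p} → Walk T (Adj T) s t p → u ∉ p → Walk T (AdjDel T u r) s t p
  Walk-delete (stop s∈) _ = stop s∈
  Walk-delete {u} {r} {s} (go {y = y} adj walk) u∉ =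
    go (adj , not-deleted) (Walk-delete walk (u∉ ∘ there))
    where
    not-deleted : ¬ IsArcUR u r s y
    not-deleted (inj₁ (refl , _)) = u∉ (here refl)
    not-deleted (inj₂ (_ , refl)) = u∉ (there (Walk-start∈ walk))

module Subtree (T : RawTree) (a : ℕ) where

  Below : ℕ → Set
  Below = Anc T a

  leave-arc : ∀ {s y} → Adj T s y → Below s → ¬ Below y → s ≡ a × y ≡ parent T a
  leave-arc (inj₁ (_ , _ , refl)) (here _)         _      = refl , refl
  leave-arc (inj₁ (_ , _ , refl)) (step _ _ above) ¬below = ⊥-elim (¬below above)
  leave-arc (inj₂ (y∈ , y≢ , refl)) below          ¬below = ⊥-elim (¬below (step y∈ y≢ below))

  enter-arc : ∀ {s y} → Adj T s y → ¬ Below s → Below y → y ≡ a × s ≡ parent T a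
  enter-arc adj ¬below below = leave-arc (Adj-sym adj) below ¬below

  Walk-delete-above⇒¬Below : ∀ {s t p} → Walk T (AdjDel T a (parent T a)) s t p →
                             ¬ Below s → ¬ Below t
  Walk-delete-above⇒¬Below (stop _) ¬below = ¬below
  Walk-delete-above⇒¬Below (go (adj , not-deleted) walk) ¬below =
    Walk-delete-above⇒¬Below walk λ below →
      let y≡a , s≡pa = enter-arc adj ¬below below in not-deleted (inj₂ (s≡pa , y≡a))

  module _ (tree : IsTree T) where

    private
      Below? : ∀ {y t p} → Walk T (Adj T) y t p → Dec (Below y)
      Below? walk = Anc?-below-root a (IsTree.reach tree _ (Walk-start∈nodes tree walk))

    enter⇒visits-root : ∀ {s t p} → Walk T (Adj T) s t p → ¬ Below s → Below t → a ∈ p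
    enter⇒visits-root (stop _) ¬below below = ⊥-elim (¬below below)
    enter⇒visits-root (go adj walk) ¬below below with Below? walk
    ... | yes below-y = there (subst (_∈ _) (proj₁ (enter-arc adj ¬below below-y)) (Walk-start∈ walk))
    ... | no ¬below-y = there (enter⇒visits-root walk ¬below-y below)

    leave⇒visits-parent : ∀ {s t p} → Walk T (Adj T) s t p → Below s → ¬ Below t → parent T a ∈ p
    leave⇒visits-parent (stop _) below ¬below = ⊥-elim (¬below below)
    leave⇒visits-parent (go adj walk) below ¬below with Below? walk
    ... | yes below-y = there (leave⇒visits-parent walk below-y ¬below)
    ... | no ¬below-y = there (subst (_∈ _) (proj₂ (leave-arc adj below ¬below-y)) (Walk-start∈ walk))

    path-inside : ∀ {s t p} → Walk T (Adj T) s t p → Unique p → Below s → Below t → All Below p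
    path-inside (stop _) _ below _ = below ∷ []
    path-inside (go adj walk) (s∉ ∷ uniq) below-s below-t with Below? walk
    ... | yes below-y = below-s ∷ path-inside walk uniq below-y below-t
    ... | no ¬below-y = ⊥-elim (All.lookup s∉ (enter⇒visits-root walk ¬below-y below-t) s≡a)
      where
      s≡a = proj₁ (leave-arc adj below-s ¬below-y)

    path-outside : ∀ {s t p} → Walk T (Adj T) s t p → Unique p →
                   ¬ Below s → ¬ Below t → All (¬_ ∘ Below) p
    path-outside (stop _) _ ¬below _ = ¬below ∷ []
    path-outside (go adj walk) (s∉ ∷ uniq) ¬below-s ¬below-t with Below? walk
    ... | no ¬below-y = ¬below-s ∷ path-outside walk uniq ¬below-y ¬below-t
    ... | yes below-y = ⊥-elim (All.lookup s∉ (leave⇒visits-parent walk below-y ¬below-t) s≡pa)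
      where
      s≡pa = proj₂ (enter-arc adj ¬below-s below-y)

lemma7 : (T₁ : RawTree) → IsTree T₁ → HeapOrdered T₁ →
         (v w u q : ℕ) → v ∈ nodes T₁ → w ∈ nodes T₁ →
         IsNCA T₁ v w u → u ≢ v → u ≢ w →
         q ∈ nodes T₁ → q ≢ root T₁ → parent T₁ q ≡ u → Anc T₁ q v →
         (T₁' : RawTree) → IsTree T₁' → Equivalent T₁ T₁' → root T₁' ≡ v →
         (r : ℕ) → parent T₁' u ≡ r →
         (∀ x → x ∈ nodes T₁ → Anc T₁ q x → InComponentDel T₁' u r v x) ×
         (∀ x → InComponentDel T₁' u r v x → ¬ Anc T₁ q x → ¬ Anc T₁ u x)
lemma7 T₁ tree heap v w u q v∈ _ (u-above-v , _ , _) u≢v _ q∈ q≢root refl q-above-v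
       T₁' tree' (same-nodes , same-min) refl _ refl = subtree⊆component , component∖subtree
  where
  u<q : u < q
  u<q = heap q q∈ q≢root

  subtree⊆component : ∀ x → x ∈ nodes T₁ → Anc T₁ q x → InComponentDel T₁' u (parent T₁' u) v x
  subtree⊆component x x∈ q-above-x
    with same-min v x v∈ x∈
  ... | m , ((p , walk , uniq , m∈p) , _) , ((p' , walk' , uniq' , _) , min') =
    p' , Walk-delete walk' λ u∈p' → <-irrefl refl (<-≤-trans u<m (min' u (p' , walk' , uniq' , u∈p')))
    where
    u<m : u < m
    u<m = <-≤-trans u<q (HeapOrdered⇒Anc⇒≤ heap
            (All.lookup (Subtree.path-inside T₁ q tree walk uniq q-above-v q-above-x) m∈p))

  component∖subtree : ∀ x → InComponentDel T₁' u (parent T₁' u) v x → ¬ Anc T₁ q x → ¬ Anc T₁ u x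
  component∖subtree x (_ , walk-del) ¬q-above-x u-above-x
    with same-min v x v∈ (Anc-bottom∈ u-above-x)
  ... | m , ((p , walk , uniq , m∈p) , min) , ((p' , walk' , uniq' , m∈p') , _) =
    All.lookup (Subtree.path-outside T₁' u tree' walk' uniq' ¬u-above'-v ¬u-above'-x) u∈p'
      (here (Equivalence.to (same-nodes u) (Anc-top∈ u-above-x)))
    where
    u∈p : u ∈ p
    u∈p = Subtree.leave⇒visits-parent T₁ q tree walk q-above-v ¬q-above-x
    m≡u : m ≡ u
    m≡u = ≤-antisym (min u (p , walk , uniq , u∈p)) (HeapOrdered⇒Anc⇒≤ heap
            (All.lookup (Subtree.path-inside T₁ u tree walk uniq u-above-v u-above-x) m∈p))
    u∈p' : u ∈ p'
    u∈p' = subst (_∈ p') m≡u m∈p'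
    ¬u-above'-v : ¬ Anc T₁' u (root T₁')
    ¬u-above'-v = u≢v ∘ Anc-root⇒≡root
    ¬u-above'-x : ¬ Anc T₁' u x
    ¬u-above'-x = Subtree.Walk-delete-above⇒¬Below T₁' u walk-del ¬u-above'-v
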